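{- Let $\Delta$ be a visibility function and $P$ a process with $\Delta\vdash P$, and let $a$ be a higher-order name not occurring free in $P$. Then $\Delta\setminus a\vdash P$.
   Context: Processes: $P::= a(x,b).P \mid h(x).P \mid \overline{a}\langle e\rangle(b).P \mid \overline{h}\langle e\rangle.P \mid \omega.P \mid\ !\alpha.P \mid P|Q \mid \nu a\,P \mid \nu h\,P \mid 0 \mid P+Q \mid \mathtt{if}\ e=f\ \mathtt{then}\ P\ \mathtt{else}\ Q$, with $a,b$ higher-order names (set $N_{ho}$), $h$ first-order names, $\omega$ success names, $x$ first-order variables, $e,f$ first-order expressions, $\alpha$ an input prefix $a(x,b)$ or $h(x)$; $\overline a\langle e\rangle(b)$ outputs $e$ with a fresh bound name $b$; inputs and restrictions bind as usual. A visibility function is a finite partial function $\Delta:N_{ho}\cup\{\mathsf{cur}\}\to\mathcal P_{fin}(N_{ho})$ that is transitive ($o,a\in\mathrm{dom}\Delta$, $a\in\Delta(o)$ imply $\Delta(a)\subseteq\Delta(o)$). $\Delta,p\mapsto V$ extends; $\Delta\setminus p$ erases the entry for $p$ and removes $p$ from all values; $\Delta_1\cup\Delta_2$: domain union, pointwise union; $(\Delta_1,\Delta_2)\in\mathrm{split}(\Delta)$ iff $\Delta_1\cup\Delta_2=\Delta$ and $\mathsf{cur}\notin\mathrm{dom}\Delta_1\cap\mathrm{dom}\Delta_2$. Typing $\Delta\vdash P$: least relation with $\Delta\vdash\overline a\langle e\rangle(b).P$ if $a\in\Delta(\mathsf{cur})$ and $(\Delta\setminus\mathsf{cur}),b\mapsto\Delta(\mathsf{cur})\cup\{b\}\vdash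 P$; $\Delta\vdash a(x,b).P$ if $\mathsf{cur}\notin\mathrm{dom}\Delta$, $a\in\mathrm{dom}\Delta$, $\Delta,\mathsf{cur}\mapsto\Delta(a)\cup\{b\}\vdash P$; $\Delta\vdash\overline h\langle e\rangle.P$ if $\Delta\vdash P$, $\mathsf{cur}\notin\mathrm{dom}\Delta$; $\Delta\vdash h(x).P$ if $\Delta\vdash P$, $\mathsf{cur}\in\mathrm{dom}\Delta$; $\Delta\vdash!\alpha.P$ if $\Delta\vdash\alpha.P$, $\mathsf{cur}\notin\mathrm{dom}\Delta$; $\Delta\vdash\omega.P$; $\Delta\setminus a\vdash\nu aP$ if $\Delta\vdash P$; $\Delta\vdash\nu hP$ if $\Delta\vdash P$; $\Delta\vdash0$ if $\mathsf{cur}\notin\mathrm{dom}\Delta$; sums/conditionals if both branches typed under $\Delta$; $\Delta\vdash P_1|P_2$ if $\Delta_i\vdash P_i$, $(\Delta_1,\Delta_2)\in\mathrm{split}(\Delta)$. -}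

module Defs where

open import Data.Nat using (ℕ; _≟_)
open import Data.List using (List; []; _∷_; _++_; filter)
open import Data.List.Membership.Propositional using (_∈_)
open import Data.Maybe using (Maybe; just; nothing; map)
open import Data.Product using (Σ; _×_; _,_; ∃; ∃-syntax)
open import Data.Sum using (_⊎_)
open import Data.Empty using (⊥)
open import Data.Unit using (⊤)
open import Relation.Nullary using (¬_; Dec; yes; no; ¬?)
open import Relation.Binary.PropositionalEquality using (_≡_; _≢_; refl; cong)
open import Function.Bundles using (_⇔_)

HName : Set
HName = ℕ

FName : Set
FName = ℕ

SName : Set
SName = ℕ

Var : Set
Var = ℕ

data Expr : Set where
  evar   : Var → Expr
  efname : FName → Expr
  econst : ℕ → Expr

data Proc : Set where
  inHO   : HName → Var → HName → Proc → Proc          -- a(x,b).P   (binds x, b)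
  inFO   : FName → Var → Proc → Proc                  -- h(x).P     (binds x)
  outHO  : HName → Expr → HName → Proc → Proc         -- a̅⟨e⟩(b).P (binds b)
  outFO  : FName → Expr → Proc → Proc
  succ   : SName → Proc → Proc
  repHO  : HName → Var → HName → Proc → Proc
  repFO  : FName → Var → Proc → Proc
  par    : Proc → Proc → Proc
  nuHO   : HName → Proc → Proc                        -- ν a P      (binds a)
  nuFO   : FName → Proc → Proc                        -- ν h P      (binds h)
  nil    : Proc
  sum    : Proc → Proc → Proc
  ite    : Expr → Expr → Proc → Proc → Proc

data _∈fn_ (n : HName) : Proc → Set where
  inHO-sub  : ∀ {x b P} → n ∈fn inHO n x b P
  inHO-body : ∀ {a x b P} → n ∈fn P → n ≢ b → n ∈fn inHO a x b P
  inFO-body : ∀ {h x P} → n ∈fn P → n ∈fn inFO h x P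
  outHO-sub : ∀ {e b P} → n ∈fn outHO n e b P
  outHO-body : ∀ {a e b P} → n ∈fn P → n ≢ b → n ∈fn outHO a e b P
  outFO-body : ∀ {h e P} → n ∈fn P → n ∈fn outFO h e P
  succ-body : ∀ {w P} → n ∈fn P → n ∈fn succ w P
  repHO-sub : ∀ {x b P} → n ∈fn repHO n x b P
  repHO-body : ∀ {a x b P} → n ∈fn P → n ≢ b → n ∈fn repHO a x b P
  repFO-body : ∀ {h x P} → n ∈fn P → n ∈fn repFO h x P
  par-l : ∀ {P Q} → n ∈fn P → n ∈fn par P Q
  par-r : ∀ {P Q} → n ∈fn Q → n ∈fn par P Q
  nuHO-body : ∀ {a P} → n ∈fn P → n ≢ a → n ∈fn nuHO a P
  nuFO-body : ∀ {h P} → n ∈fn P → n ∈fn nuFO h P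
  sum-l : ∀ {P Q} → n ∈fn P → n ∈fn sum P Q
  sum-r : ∀ {P Q} → n ∈fn Q → n ∈fn sum P Q
  ite-l : ∀ {e f P Q} → n ∈fn P → n ∈fn ite e f P Q
  ite-r : ∀ {e f P Q} → n ∈fn Q → n ∈fn ite e f P Q

data _∈nm_ (n : HName) : Proc → Set where
  inHO-sub  : ∀ {x b P} → n ∈nm inHO n x b P
  inHO-bnd  : ∀ {a x P} → n ∈nm inHO a x n P
  inHO-body : ∀ {a x b P} → n ∈nm P → n ∈nm inHO a x b P
  inFO-body : ∀ {h x P} → n ∈nm P → n ∈nm inFO h x P
  outHO-sub : ∀ {e b P} → n ∈nm outHO n e b P
  outHO-bnd : ∀ {a e P} → n ∈nm outHO a e n P
  outHO-body : ∀ {a e b P} → n ∈nm P → n ∈nm outHO a e b P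
  outFO-body : ∀ {h e P} → n ∈nm P → n ∈nm outFO h e P
  succ-body : ∀ {w P} → n ∈nm P → n ∈nm succ w P
  repHO-sub : ∀ {x b P} → n ∈nm repHO n x b P
  repHO-bnd : ∀ {a x P} → n ∈nm repHO a x n P
  repHO-body : ∀ {a x b P} → n ∈nm P → n ∈nm repHO a x b P
  repFO-body : ∀ {h x P} → n ∈nm P → n ∈nm repFO h x P
  par-l : ∀ {P Q} → n ∈nm P → n ∈nm par P Q
  par-r : ∀ {P Q} → n ∈nm Q → n ∈nm par P Q
  nuHO-bnd : ∀ {P} → n ∈nm nuHO n P
  nuHO-body : ∀ {a P} → n ∈nm P → n ∈nm nuHO a P
  nuFO-body : ∀ {h P} → n ∈nm P → n ∈nm nuFO h P
  sum-l : ∀ {P Q} → n ∈nm P → n ∈nm sum P Q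
  sum-r : ∀ {P Q} → n ∈nm Q → n ∈nm sum P Q
  ite-l : ∀ {e f P Q} → n ∈nm P → n ∈nm ite e f P Q
  ite-r : ∀ {e f P Q} → n ∈nm Q → n ∈nm ite e f P Q

swapN : HName → HName → HName → HName
swapN a b c with c ≟ a
... | yes _ = b
... | no _ with c ≟ b
...   | yes _ = a
...   | no _ = c

swap : HName → HName → Proc → Proc
swap a b (inHO s x c P) = inHO (swapN a b s) x (swapN a b c) (swap a b P)
swap a b (inFO h x P) = inFO h x (swap a b P)
swap a b (outHO s e c P) = outHO (swapN a b s) e (swapN a b c) (swap a b P)
swap a b (outFO h e P) = outFO h e (swap a b P)
swap a b (succ w P) = succ w (swap a b P)
swap a b (repHO s x c P) = repHO (swapN a b s) x (swapN a b c) (swap a b P)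
swap a b (repFO h x P) = repFO h x (swap a b P)
swap a b (par P Q) = par (swap a b P) (swap a b Q)
swap a b (nuHO c P) = nuHO (swapN a b c) (swap a b P)
swap a b (nuFO h P) = nuFO h (swap a b P)
swap a b nil = nil
swap a b (sum P Q) = sum (swap a b P) (swap a b Q)
swap a b (ite e f P Q) = ite e f (swap a b P) (swap a b Q)

FreshFor : HName → HName → HName → Proc → Proc → Set
FreshFor c b b' P P' = (c ≢ b) × (c ≢ b') × ¬ (c ∈nm P) × ¬ (c ∈nm P')

data _=α_ : Proc → Proc → Set where
  inHO  : ∀ {a x b b' P P'} c → FreshFor c b b' P P' →
          swap b c P =α swap b' c P' → inHO a x b P =α inHO a x b' P'
  inFO  : ∀ {h x P P'} → P =α P' → inFO h x P =α inFO h x P'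
  outHO : ∀ {a e b b' P P'} c → FreshFor c b b' P P' →
          swap b c P =α swap b' c P' → outHO a e b P =α outHO a e b' P'
  outFO : ∀ {h e P P'} → P =α P' → outFO h e P =α outFO h e P'
  succ  : ∀ {w P P'} → P =α P' → succ w P =α succ w P'
  repHO : ∀ {a x b b' P P'} c → FreshFor c b b' P P' →
          swap b c P =α swap b' c P' → repHO a x b P =α repHO a x b' P'
  repFO : ∀ {h x P P'} → P =α P' → repFO h x P =α repFO h x P'
  par   : ∀ {P P' Q Q'} → P =α P' → Q =α Q' → par P Q =α par P' Q'
  nuHO  : ∀ {b b' P P'} c → FreshFor c b b' P P' →
          swap b c P =α swap b' c P' → nuHO b P =α nuHO b' P'
  nuFO  : ∀ {h P P'} → P =α P' → nuFO h P =α nuFO h P'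
  nil   : nil =α nil
  sum   : ∀ {P P' Q Q'} → P =α P' → Q =α Q' → sum P Q =α sum P' Q'
  ite   : ∀ {e f P P' Q Q'} → P =α P' → Q =α Q' → ite e f P Q =α ite e f P' Q'

data Key : Set where
  cur : Key
  ho  : HName → Key

_≟K_ : (k l : Key) → Dec (k ≡ l)
cur ≟K cur = yes refl
cur ≟K ho _ = no (λ ())
ho _ ≟K cur = no (λ ())
ho a ≟K ho b with a ≟ b
... | yes refl = yes refl
... | no ne = no (λ { refl → ne refl })

-- A partial function N_ho ∪ {cur} → finite sets of N_ho
-- (finite sets are represented by lists, compared by membership).
VMap : Set
VMap = Key → Maybe (List HName)

InDom : VMap → Key → Set
InDom Δ k = ∃[ V ] (Δ k ≡ just V)

_∈at_ : HName → VMap × Key → Set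
a ∈at (Δ , k) = ∃[ V ] ((Δ k ≡ just V) × (a ∈ V))

FiniteDom : VMap → Set
FiniteDom Δ = ∃[ ks ] (∀ k → InDom Δ k → k ∈ ks)

Transitive : VMap → Set
Transitive Δ = ∀ o a → InDom Δ o → InDom Δ (ho a) → a ∈at (Δ , o) →
               ∀ c → c ∈at (Δ , ho a) → c ∈at (Δ , o)

IsVis : VMap → Set
IsVis Δ = FiniteDom Δ × Transitive Δ

-- Δ , p ↦ V   (extension; used only when p ∉ dom Δ)
_,_↦_ : VMap → Key → List HName → VMap
(Δ , p ↦ V) k with k ≟K p
... | yes _ = just V
... | no _ = Δ k

-- remove a key from a value set (only higher-order names occur in values)
delK : Key → List HName → List HName
delK cur V = V
delK (ho a) V = filter (λ y → ¬? (y ≟ a)) V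

_∖_ : VMap → Key → VMap
(Δ ∖ p) k with k ≟K p
... | yes _ = nothing
... | no _ = map (delK p) (Δ k)

unionM : Maybe (List HName) → Maybe (List HName) → Maybe (List HName)
unionM nothing  m        = m
unionM (just V) nothing  = just V
unionM (just V) (just W) = just (V ++ W)

_∪V_ : VMap → VMap → VMap
(Δ₁ ∪V Δ₂) k = unionM (Δ₁ k) (Δ₂ k)

SameM : Maybe (List HName) → Maybe (List HName) → Set
SameM nothing  nothing  = ⊤
SameM nothing  (just _) = ⊥
SameM (just _) nothing  = ⊥
SameM (just V) (just W) = ∀ x → (x ∈ V) ⇔ (x ∈ W)

_≐_ : VMap → VMap → Set
Δ ≐ Δ' = ∀ k → SameM (Δ k) (Δ' k)

Split : VMap → VMap → VMap → Set
Split Δ₁ Δ₂ Δ = ((Δ₁ ∪V Δ₂) ≐ Δ) × ¬ (InDom Δ₁ cur × InDom Δ₂ cur)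

-- b does not occur in Δ at all (neither in the domain nor in any value);
-- bound names are chosen fresh (Barendregt convention)
FreshΔ : HName → VMap → Set
FreshΔ b Δ = ¬ InDom Δ (ho b) × (∀ k → ¬ (b ∈at (Δ , k)))

data _⊢ʳ_ : VMap → Proc → Set where
  t-outHO : ∀ {Δ a e b P} V → IsVis Δ → Δ cur ≡ just V → a ∈ V → FreshΔ b Δ →
            ((Δ ∖ cur) , ho b ↦ (b ∷ V)) ⊢ʳ P → Δ ⊢ʳ outHO a e b P
  t-inHO  : ∀ {Δ a x b P} V → IsVis Δ → ¬ InDom Δ cur → Δ (ho a) ≡ just V →
            FreshΔ b Δ → (Δ , cur ↦ (b ∷ V)) ⊢ʳ P → Δ ⊢ʳ inHO a x b P
  t-outFO : ∀ {Δ h e P} → IsVis Δ → Δ ⊢ʳ P → ¬ InDom Δ cur → Δ ⊢ʳ outFO h e P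
  t-inFO  : ∀ {Δ h x P} → IsVis Δ → Δ ⊢ʳ P → InDom Δ cur → Δ ⊢ʳ inFO h x P
  t-repHO : ∀ {Δ a x b P} → IsVis Δ → Δ ⊢ʳ inHO a x b P → ¬ InDom Δ cur →
            Δ ⊢ʳ repHO a x b P
  t-repFO : ∀ {Δ h x P} → IsVis Δ → Δ ⊢ʳ inFO h x P → ¬ InDom Δ cur →
            Δ ⊢ʳ repFO h x P
  t-succ  : ∀ {Δ w P} → IsVis Δ → Δ ⊢ʳ succ w P
  t-nuHO  : ∀ {Δ Δ' a P} → IsVis Δ' → Δ ⊢ʳ P → Δ' ≐ (Δ ∖ ho a) → Δ' ⊢ʳ nuHO a P
  t-nuFO  : ∀ {Δ h P} → IsVis Δ → Δ ⊢ʳ P → Δ ⊢ʳ nuFO h P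
  t-nil   : ∀ {Δ} → IsVis Δ → ¬ InDom Δ cur → Δ ⊢ʳ nil
  t-sum   : ∀ {Δ P Q} → IsVis Δ → Δ ⊢ʳ P → Δ ⊢ʳ Q → Δ ⊢ʳ sum P Q
  t-ite   : ∀ {Δ e f P Q} → IsVis Δ → Δ ⊢ʳ P → Δ ⊢ʳ Q → Δ ⊢ʳ ite e f P Q
  t-par   : ∀ {Δ Δ₁ Δ₂ P Q} → IsVis Δ → Split Δ₁ Δ₂ Δ → Δ₁ ⊢ʳ P → Δ₂ ⊢ʳ Q →
            Δ ⊢ʳ par P Q

-- Typing of processes up to α-equivalence (the paper's Δ ⊢ P)
_⊢_ : VMap → Proc → Set
Δ ⊢ P = ∃[ Q ] ((P =α Q) × (Δ ⊢ʳ Q))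

-- Erasing a name a that is not free in P
-- commutes with every operation the typing rules perform on visibility functions
-- (extending, erasing cur or a bound name, splitting), and it preserves visibility,
-- so each rule instance stays an instance after erasing a.  At a binder for a
-- itself, a is fresh for the current visibility function (input and output) or is
-- erased anyway (restriction), so erasing it again changes nothing.  Finally,
-- α-equivalent processes have the same free names, which lifts the result from
-- raw terms to typing up to α-equivalence.
module Submission where

open import Defs

open import Data.Nat using (_≟_)
open import Data.List using (List; _∷_; _++_)
open import Data.List.Membership.Propositional using (_∈_)
open import Data.List.Membership.Propositional.Properties
  using (∈-filter⁺; ∈-filter⁻; ∈-++⁺ˡ; ∈-++⁺ʳ; ∈-++⁻)
open import Data.List.Relation.Unary.Any using (here; there)
open import Data.Maybe using (just; nothing; map)
open import Data.Maybe.Properties using (just-injective)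
open import Data.Product using (Σ; _×_; _,_; proj₁; proj₂)
open import Data.Sum using (inj₁; inj₂)
open import Data.Empty using (⊥-elim)
open import Data.Unit using (tt)
open import Relation.Nullary using (¬_; Dec; yes; no; ¬?)
open import Relation.Binary.PropositionalEquality
  using (_≡_; _≢_; refl; cong; sym; trans; subst)
open import Relation.Binary.Structures using (IsEquivalence)
open import Function.Base using (_∘_)
open import Function.Bundles using (_⇔_; mk⇔; Equivalence)
open import Function.Properties.Equivalence using (⇔-isEquivalence)
open import Level using (0ℓ)

open Equivalence using (to; from)
private module ⇔ = IsEquivalence (⇔-isEquivalence {ℓ = 0ℓ})

-- Erasure on value sets

∈-delK⁻ : ∀ p {x V} → x ∈ delK p V → x ∈ V × p ≢ ho x
∈-delK⁻ cur x∈V = x∈V , λ ()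
∈-delK⁻ (ho a) x∈ with ∈-filter⁻ (λ y → ¬? (y ≟ a)) x∈
... | x∈V , x≢a = x∈V , λ { refl → x≢a refl }

∈-delK⁺ : ∀ p {x V} → x ∈ V → p ≢ ho x → x ∈ delK p V
∈-delK⁺ cur x∈V _ = x∈V
∈-delK⁺ (ho a) x∈V a≢x = ∈-filter⁺ (λ y → ¬? (y ≟ a)) x∈V λ { refl → a≢x refl }

SameL : List HName → List HName → Set
SameL V W = ∀ x → (x ∈ V) ⇔ (x ∈ W)

SameM-refl : ∀ m → SameM m m
SameM-refl nothing  = tt
SameM-refl (just V) = λ _ → ⇔.refl

SameM-sym : ∀ m m' → SameM m m' → SameM m' m
SameM-sym nothing  nothing  _ = tt
SameM-sym (just V) (just W) s = λ x → ⇔.sym (s x)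

SameM-trans : ∀ m m' m'' → SameM m m' → SameM m' m'' → SameM m m''
SameM-trans nothing  nothing  nothing  _ _ = tt
SameM-trans (just U) (just V) (just W) s t = λ x → ⇔.trans (s x) (t x)

≐-refl : ∀ {Δ} → Δ ≐ Δ
≐-refl {Δ} k = SameM-refl (Δ k)

≐-sym : ∀ {Δ Δ'} → Δ ≐ Δ' → Δ' ≐ Δ
≐-sym {Δ} {Δ'} e k = SameM-sym (Δ k) (Δ' k) (e k)

≐-trans : ∀ {Δ Δ' Δ''} → Δ ≐ Δ' → Δ' ≐ Δ'' → Δ ≐ Δ''
≐-trans {Δ} {Δ'} {Δ''} e f k = SameM-trans (Δ k) (Δ' k) (Δ'' k) (e k) (f k)

SameM-just : ∀ m m' {V} → SameM m m' → m ≡ just V → Σ (List HName) λ W → m' ≡ just W × SameL V W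
SameM-just (just V) (just W) s refl = W , refl , s

∷-cong : ∀ b {V W} → SameL V W → SameL (b ∷ V) (b ∷ W)
∷-cong b s x = mk⇔ (along (to (s x))) (along (from (s x)))
  where
  along : ∀ {V W} → (x ∈ V → x ∈ W) → x ∈ b ∷ V → x ∈ b ∷ W
  along f (here e)  = here e
  along f (there m) = there (f m)

delK-cong : ∀ p {V W} → SameL V W → SameL (delK p V) (delK p W)
delK-cong p s x = mk⇔ (along (to (s x))) (along (from (s x)))
  where
  along : ∀ {V W} → (x ∈ V → x ∈ W) → x ∈ delK p V → x ∈ delK p W
  along f m = let x∈V , p≢x = ∈-delK⁻ p m in ∈-delK⁺ p (f x∈V) p≢x

delK-∷ : ∀ {a b} V → b ≢ a → SameL (delK (ho a) (b ∷ V)) (b ∷ delK (ho a) V)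
delK-∷ {a} {b} V b≢a x = mk⇔ fw bw
  where
  fw : x ∈ delK (ho a) (b ∷ V) → x ∈ b ∷ delK (ho a) V
  fw m with ∈-delK⁻ (ho a) {x} {b ∷ V} m
  ... | here refl  , _   = here refl
  ... | there x∈V , a≢x = there (∈-delK⁺ (ho a) x∈V a≢x)
  bw : x ∈ b ∷ delK (ho a) V → x ∈ delK (ho a) (b ∷ V)
  bw (here refl) = ∈-delK⁺ (ho a) {b} {b ∷ V} (here refl) λ { refl → b≢a refl }
  bw (there m)   = let x∈V , a≢x = ∈-delK⁻ (ho a) m in ∈-delK⁺ (ho a) {x} {b ∷ V} (there x∈V) a≢x

-- Erasure on visibility functions

∖-lookup-self : ∀ {Δ p k} → k ≡ p → (Δ ∖ p) k ≡ nothing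
∖-lookup-self {Δ} {p} {k} k≡p with k ≟K p
... | yes _ = refl
... | no k≢p = ⊥-elim (k≢p k≡p)

∖-lookup-other : ∀ {Δ p k} → k ≢ p → (Δ ∖ p) k ≡ map (delK p) (Δ k)
∖-lookup-other {Δ} {p} {k} k≢p with k ≟K p
... | yes k≡p = ⊥-elim (k≢p k≡p)
... | no _ = refl

↦-lookup-self : ∀ {Δ p V k} → k ≡ p → (Δ , p ↦ V) k ≡ just V
↦-lookup-self {Δ} {p} {V} {k} k≡p with k ≟K p
... | yes _ = refl
... | no k≢p = ⊥-elim (k≢p k≡p)

↦-lookup-other : ∀ {Δ p V k} → k ≢ p → (Δ , p ↦ V) k ≡ Δ k
↦-lookup-other {Δ} {p} {V} {k} k≢p with k ≟K p
... | yes k≡p = ⊥-elim (k≢p k≡p)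
... | no _ = refl

∖-lookup-just : ∀ {Δ p k V} → k ≢ p → Δ k ≡ just V → (Δ ∖ p) k ≡ just (delK p V)
∖-lookup-just {Δ} {p} k≢p eq = trans (∖-lookup-other {Δ} k≢p) (cong (map (delK p)) eq)

∖-lookup-just⁻ : ∀ {Δ p k V} → (Δ ∖ p) k ≡ just V →
                 k ≢ p × Σ (List HName) λ W → Δ k ≡ just W × V ≡ delK p W
∖-lookup-just⁻ {Δ} {p} {k} eq with k ≟K p
... | no k≢p with Δ k
...   | just W = k≢p , W , refl , sym (just-injective eq)

∖-cong : ∀ {Δ Δ'} p → Δ ≐ Δ' → (Δ ∖ p) ≐ (Δ' ∖ p)
∖-cong {Δ} {Δ'} p e k with k ≟K p
... | yes _ = tt
... | no _ = mapDel (Δ k) (Δ' k) (e k)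
  where
  mapDel : ∀ m m' → SameM m m' → SameM (map (delK p) m) (map (delK p) m')
  mapDel nothing  nothing  _ = tt
  mapDel (just V) (just W) s = delK-cong p s

↦-cong : ∀ {Δ Δ'} p {V W} → Δ ≐ Δ' → SameL V W → (Δ , p ↦ V) ≐ (Δ' , p ↦ W)
↦-cong p e s k with k ≟K p
... | yes _ = s
... | no _ = e k

∖-idem : ∀ {Δ} p → ((Δ ∖ p) ∖ p) ≐ (Δ ∖ p)
∖-idem {Δ} p k with k ≟K p
... | yes k≡p rewrite ∖-lookup-self {Δ ∖ p} k≡p | ∖-lookup-self {Δ} k≡p = tt
... | no k≢p rewrite ∖-lookup-other {Δ ∖ p} k≢p | ∖-lookup-other {Δ} k≢p with Δ k
...   | nothing = tt
...   | just V = λ x → mk⇔ (λ m → ∈-delK⁻ p m .proj₁) (λ m → ∈-delK⁺ p m (∈-delK⁻ p m .proj₂))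

∖-comm : ∀ {Δ} p q → ((Δ ∖ p) ∖ q) ≐ ((Δ ∖ q) ∖ p)
∖-comm {Δ} p q k with k ≟K p | k ≟K q
... | yes k≡p | yes k≡q rewrite ∖-lookup-self {Δ ∖ p} k≡q | ∖-lookup-self {Δ ∖ q} k≡p = tt
... | yes k≡p | no k≢q
  rewrite ∖-lookup-other {Δ ∖ p} k≢q | ∖-lookup-self {Δ ∖ q} k≡p | ∖-lookup-self {Δ} k≡p = tt
... | no k≢p | yes k≡q
  rewrite ∖-lookup-self {Δ ∖ p} k≡q | ∖-lookup-other {Δ ∖ q} k≢p | ∖-lookup-self {Δ} k≡q = tt
... | no k≢p | no k≢q
  rewrite ∖-lookup-other {Δ ∖ p} k≢q | ∖-lookup-other {Δ ∖ q} k≢p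
        | ∖-lookup-other {Δ} k≢p | ∖-lookup-other {Δ} k≢q with Δ k
...   | nothing = tt
...   | just V = λ x → mk⇔ (swapDel p q) (swapDel q p)
  where
  swapDel : ∀ p q {x} → x ∈ delK q (delK p V) → x ∈ delK p (delK q V)
  swapDel p q m = let m₁ , q≢x = ∈-delK⁻ q m ; x∈V , p≢x = ∈-delK⁻ p m₁
                  in ∈-delK⁺ p (∈-delK⁺ q x∈V q≢x) p≢x

↦-∖ : ∀ {Δ} p q V → q ≢ p → ((Δ , q ↦ V) ∖ p) ≐ ((Δ ∖ p) , q ↦ delK p V)
↦-∖ {Δ} p q V q≢p k with k ≟K p | k ≟K q
... | yes refl | yes refl = ⊥-elim (q≢p refl)
... | yes k≡p | no k≢q
  rewrite ∖-lookup-self {Δ , q ↦ V} k≡p | ↦-lookup-other {Δ ∖ p} {q} {delK p V} k≢q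
        | ∖-lookup-self {Δ} k≡p = tt
... | no k≢p | yes k≡q
  rewrite ∖-lookup-other {Δ , q ↦ V} k≢p | ↦-lookup-self {Δ ∖ p} {q} {delK p V} k≡q
        | ↦-lookup-self {Δ} {q} {V} k≡q = λ _ → ⇔.refl
... | no k≢p | no k≢q
  rewrite ∖-lookup-other {Δ , q ↦ V} k≢p | ↦-lookup-other {Δ ∖ p} {q} {delK p V} k≢q
        | ↦-lookup-other {Δ} {q} {V} k≢q | ∖-lookup-other {Δ} k≢p = SameM-refl _

∪V-∖ : ∀ {Δ₁ Δ₂} p → ((Δ₁ ∖ p) ∪V (Δ₂ ∖ p)) ≐ ((Δ₁ ∪V Δ₂) ∖ p)
∪V-∖ {Δ₁} {Δ₂} p k with k ≟K p
... | yes _ = tt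
... | no _ with Δ₁ k | Δ₂ k
...   | nothing | nothing = tt
...   | nothing | just W  = λ _ → ⇔.refl
...   | just V  | nothing = λ _ → ⇔.refl
...   | just V  | just W  = λ x → mk⇔ (fw x) (bw x)
  where
  fw : ∀ x → x ∈ delK p V ++ delK p W → x ∈ delK p (V ++ W)
  fw x m with ∈-++⁻ (delK p V) m
  ... | inj₁ m' = let x∈V , p≢x = ∈-delK⁻ p m' in ∈-delK⁺ p (∈-++⁺ˡ x∈V) p≢x
  ... | inj₂ m' = let x∈W , p≢x = ∈-delK⁻ p m' in ∈-delK⁺ p (∈-++⁺ʳ V x∈W) p≢x
  bw : ∀ x → x ∈ delK p (V ++ W) → x ∈ delK p V ++ delK p W
  bw x m with ∈-delK⁻ p m
  ... | x∈VW , p≢x with ∈-++⁻ V x∈VW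
  ...   | inj₁ x∈V = ∈-++⁺ˡ (∈-delK⁺ p x∈V p≢x)
  ...   | inj₂ x∈W = ∈-++⁺ʳ (delK p V) (∈-delK⁺ p x∈W p≢x)

∖-fresh : ∀ {Δ a} → FreshΔ a Δ → (Δ ∖ ho a) ≐ Δ
∖-fresh {Δ} {a} (a∉dom , a∉val) k with k ≟K ho a
... | yes refl with Δ (ho a)
...   | nothing = tt
...   | just V = a∉dom (V , refl)
∖-fresh {Δ} {a} (a∉dom , a∉val) k | no _ with Δ k in eq
...   | nothing = tt
...   | just V = λ x → mk⇔ (λ m → ∈-delK⁻ (ho a) m .proj₁)
                          (λ m → ∈-delK⁺ (ho a) m λ { refl → a∉val k (V , eq , m) })

InDom-≐ : ∀ {Δ Δ' k} → Δ ≐ Δ' → InDom Δ k → InDom Δ' k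
InDom-≐ {Δ} {Δ'} {k} e (V , eq) with SameM-just (Δ k) (Δ' k) (e k) eq
... | W , eq' , _ = W , eq'

∈at-≐ : ∀ {Δ Δ' k x} → Δ ≐ Δ' → x ∈at (Δ , k) → x ∈at (Δ' , k)
∈at-≐ {Δ} {Δ'} {k} {x} e (V , eq , x∈V) with SameM-just (Δ k) (Δ' k) (e k) eq
... | W , eq' , s = W , eq' , to (s x) x∈V

InDom-∖⁻ : ∀ {Δ p k} → InDom (Δ ∖ p) k → InDom Δ k × k ≢ p
InDom-∖⁻ {Δ} (_ , eq) with ∖-lookup-just⁻ {Δ} eq
... | k≢p , W , eq' , _ = (W , eq') , k≢p

InDom-∖⁺ : ∀ {Δ p k} → InDom Δ k → k ≢ p → InDom (Δ ∖ p) k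
InDom-∖⁺ {Δ} (V , eq) k≢p = _ , ∖-lookup-just {Δ} k≢p eq

∈at-∖⁻ : ∀ {Δ p k x} → x ∈at (Δ ∖ p , k) → x ∈at (Δ , k) × p ≢ ho x
∈at-∖⁻ {Δ} {p} (_ , eq , x∈) with ∖-lookup-just⁻ {Δ} {p} eq
... | _ , W , eq' , refl = let x∈W , p≢x = ∈-delK⁻ p x∈ in (W , eq' , x∈W) , p≢x

∈at-∖⁺ : ∀ {Δ p k x} → x ∈at (Δ , k) → k ≢ p → p ≢ ho x → x ∈at (Δ ∖ p , k)
∈at-∖⁺ {Δ} {p} (V , eq , x∈V) k≢p p≢x = delK p V , ∖-lookup-just {Δ} k≢p eq , ∈-delK⁺ p x∈V p≢x

IsVis-≐ : ∀ {Δ Δ'} → Δ ≐ Δ' → IsVis Δ → IsVis Δ'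
IsVis-≐ e ((ks , fin) , tr) =
  (ks , λ k d → fin k (InDom-≐ (≐-sym e) d)) ,
  λ o a o∈ a∈ a∈o c c∈a →
    ∈at-≐ e (tr o a (InDom-≐ (≐-sym e) o∈) (InDom-≐ (≐-sym e) a∈)
                   (∈at-≐ (≐-sym e) a∈o) c (∈at-≐ (≐-sym e) c∈a))

IsVis-∖ : ∀ {Δ} p → IsVis Δ → IsVis (Δ ∖ p)
IsVis-∖ {Δ} p ((ks , fin) , tr) =
  (ks , λ k d → fin k (InDom-∖⁻ {Δ} {p} d .proj₁)) ,
  λ o a o∈ a∈ a∈o c c∈a →
    let o∈Δ , o≢p = InDom-∖⁻ {Δ} {p} o∈
        a∈Δ , _ = InDom-∖⁻ {Δ} {p} a∈
        a∈oΔ , _ = ∈at-∖⁻ {Δ} {p} a∈o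
        c∈aΔ , p≢c = ∈at-∖⁻ {Δ} {p} {ho a} c∈a
    in ∈at-∖⁺ {Δ} (tr o a o∈Δ a∈Δ a∈oΔ c c∈aΔ) o≢p p≢c

FreshΔ-≐ : ∀ {Δ Δ' b} → Δ ≐ Δ' → FreshΔ b Δ → FreshΔ b Δ'
FreshΔ-≐ e (b∉dom , b∉val) =
  (λ d → b∉dom (InDom-≐ (≐-sym e) d)) , (λ k m → b∉val k (∈at-≐ (≐-sym e) m))

FreshΔ-∖ : ∀ {Δ b} p → FreshΔ b Δ → FreshΔ b (Δ ∖ p)
FreshΔ-∖ {Δ} p (b∉dom , b∉val) =
  (λ d → b∉dom (InDom-∖⁻ {Δ} {p} d .proj₁)) , (λ k m → b∉val k (∈at-∖⁻ {Δ} {p} m .proj₁))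

Split-∖ : ∀ {Δ Δ₁ Δ₂} p → Split Δ₁ Δ₂ Δ → Split (Δ₁ ∖ p) (Δ₂ ∖ p) (Δ ∖ p)
Split-∖ {Δ} {Δ₁} {Δ₂} p (∪≐ , disjoint) =
  ≐-trans (∪V-∖ {Δ₁} {Δ₂} p) (∖-cong p ∪≐) ,
  λ (d₁ , d₂) → disjoint (InDom-∖⁻ {Δ₁} {p} d₁ .proj₁ , InDom-∖⁻ {Δ₂} {p} d₂ .proj₁)

-- Raw typing

¬InDom-≐ : ∀ {Δ Δ' k} → Δ ≐ Δ' → ¬ InDom Δ k → ¬ InDom Δ' k
¬InDom-≐ e k∉ d = k∉ (InDom-≐ (≐-sym e) d)

⊢ʳ-resp-≐ : ∀ {Δ Δ' P} → Δ ≐ Δ' → Δ ⊢ʳ P → Δ' ⊢ʳ P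
⊢ʳ-resp-≐ {Δ} {Δ'} e (t-outHO {a = a} {b = b} V vis eq a∈V fr ⊢P)
  with SameM-just (Δ cur) (Δ' cur) (e cur) eq
... | W , eq' , s =
  t-outHO W (IsVis-≐ e vis) eq' (to (s a) a∈V) (FreshΔ-≐ e fr)
    (⊢ʳ-resp-≐ (↦-cong (ho b) (∖-cong cur e) (∷-cong b s)) ⊢P)
⊢ʳ-resp-≐ {Δ} {Δ'} e (t-inHO {a = a} {b = b} V vis cur∉ eq fr ⊢P)
  with SameM-just (Δ (ho a)) (Δ' (ho a)) (e (ho a)) eq
... | W , eq' , s =
  t-inHO W (IsVis-≐ e vis) (¬InDom-≐ e cur∉) eq' (FreshΔ-≐ e fr)
    (⊢ʳ-resp-≐ (↦-cong cur e (∷-cong b s)) ⊢P)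
⊢ʳ-resp-≐ e (t-outFO vis ⊢P cur∉) = t-outFO (IsVis-≐ e vis) (⊢ʳ-resp-≐ e ⊢P) (¬InDom-≐ e cur∉)
⊢ʳ-resp-≐ e (t-inFO vis ⊢P cur∈) = t-inFO (IsVis-≐ e vis) (⊢ʳ-resp-≐ e ⊢P) (InDom-≐ e cur∈)
⊢ʳ-resp-≐ e (t-repHO vis ⊢P cur∉) = t-repHO (IsVis-≐ e vis) (⊢ʳ-resp-≐ e ⊢P) (¬InDom-≐ e cur∉)
⊢ʳ-resp-≐ e (t-repFO vis ⊢P cur∉) = t-repFO (IsVis-≐ e vis) (⊢ʳ-resp-≐ e ⊢P) (¬InDom-≐ e cur∉)
⊢ʳ-resp-≐ e (t-succ vis) = t-succ (IsVis-≐ e vis)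
⊢ʳ-resp-≐ e (t-nuHO vis ⊢P e') = t-nuHO (IsVis-≐ e vis) ⊢P (≐-trans (≐-sym e) e')
⊢ʳ-resp-≐ e (t-nuFO vis ⊢P) = t-nuFO (IsVis-≐ e vis) (⊢ʳ-resp-≐ e ⊢P)
⊢ʳ-resp-≐ e (t-nil vis cur∉) = t-nil (IsVis-≐ e vis) (¬InDom-≐ e cur∉)
⊢ʳ-resp-≐ e (t-sum vis ⊢P ⊢Q) = t-sum (IsVis-≐ e vis) (⊢ʳ-resp-≐ e ⊢P) (⊢ʳ-resp-≐ e ⊢Q)
⊢ʳ-resp-≐ e (t-ite vis ⊢P ⊢Q) = t-ite (IsVis-≐ e vis) (⊢ʳ-resp-≐ e ⊢P) (⊢ʳ-resp-≐ e ⊢Q)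
⊢ʳ-resp-≐ e (t-par vis (∪≐ , disjoint) ⊢P ⊢Q) = t-par (IsVis-≐ e vis) (≐-trans ∪≐ e , disjoint) ⊢P ⊢Q

¬InDom-∖ : ∀ {Δ k} p → ¬ InDom Δ k → ¬ InDom (Δ ∖ p) k
¬InDom-∖ {Δ} p k∉ d = k∉ (InDom-∖⁻ {Δ} {p} d .proj₁)

ho-≢ : ∀ {a b} → a ≢ b → ho a ≢ ho b
ho-≢ a≢b refl = a≢b refl

∈fn-inHO⇒repHO : ∀ {n a x b P} → n ∈fn inHO a x b P → n ∈fn repHO a x b P
∈fn-inHO⇒repHO inHO-sub = repHO-sub
∈fn-inHO⇒repHO (inHO-body m n≢b) = repHO-body m n≢b

∈fn-inFO⇒repFO : ∀ {n h x P} → n ∈fn inFO h x P → n ∈fn repFO h x P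
∈fn-inFO⇒repFO (inFO-body m) = repFO-body m

strengthenʳ : ∀ {Δ P} a → Δ ⊢ʳ P → ¬ (a ∈fn P) → (Δ ∖ ho a) ⊢ʳ P
strengthenʳ {Δ} a ⊢R@(t-outHO {b = b} V vis eq s∈V fr ⊢P) a∉ with a ≟ b
... | yes refl = ⊢ʳ-resp-≐ (≐-sym (∖-fresh fr)) ⊢R
... | no a≢b =
  t-outHO (delK (ho a) V) (IsVis-∖ (ho a) vis) (∖-lookup-just {Δ} (λ ()) eq)
    (∈-delK⁺ (ho a) s∈V λ { refl → a∉ outHO-sub }) (FreshΔ-∖ (ho a) fr)
    (⊢ʳ-resp-≐ body (strengthenʳ a ⊢P λ m → a∉ (outHO-body m a≢b)))
  where
  body : (((Δ ∖ cur) , ho b ↦ (b ∷ V)) ∖ ho a) ≐ (((Δ ∖ ho a) ∖ cur) , ho b ↦ (b ∷ delK (ho a) V))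
  body = ≐-trans (↦-∖ {Δ ∖ cur} (ho a) (ho b) (b ∷ V) (ho-≢ λ b≡a → a≢b (sym b≡a)))
                 (↦-cong (ho b) (∖-comm {Δ} cur (ho a)) (delK-∷ V λ b≡a → a≢b (sym b≡a)))
strengthenʳ {Δ} a ⊢R@(t-inHO {b = b} V vis cur∉ eq fr ⊢P) a∉ with a ≟ b
... | yes refl = ⊢ʳ-resp-≐ (≐-sym (∖-fresh fr)) ⊢R
... | no a≢b =
  t-inHO (delK (ho a) V) (IsVis-∖ (ho a) vis) (¬InDom-∖ {Δ} (ho a) cur∉)
    (∖-lookup-just {Δ} (ho-≢ λ { refl → a∉ inHO-sub }) eq) (FreshΔ-∖ (ho a) fr)
    (⊢ʳ-resp-≐ body (strengthenʳ a ⊢P λ m → a∉ (inHO-body m a≢b)))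
  where
  body : ((Δ , cur ↦ (b ∷ V)) ∖ ho a) ≐ ((Δ ∖ ho a) , cur ↦ (b ∷ delK (ho a) V))
  body = ≐-trans (↦-∖ {Δ} (ho a) cur (b ∷ V) (λ ()))
                 (↦-cong cur (≐-refl {Δ ∖ ho a}) (delK-∷ V λ b≡a → a≢b (sym b≡a)))
strengthenʳ {Δ} a (t-outFO vis ⊢P cur∉) a∉ =
  t-outFO (IsVis-∖ (ho a) vis) (strengthenʳ a ⊢P (a∉ ∘ outFO-body)) (¬InDom-∖ {Δ} (ho a) cur∉)
strengthenʳ {Δ} a (t-inFO vis ⊢P cur∈) a∉ =
  t-inFO (IsVis-∖ (ho a) vis) (strengthenʳ a ⊢P (a∉ ∘ inFO-body)) (InDom-∖⁺ {Δ} {ho a} cur∈ λ ())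
strengthenʳ {Δ} a (t-repHO vis ⊢P cur∉) a∉ =
  t-repHO (IsVis-∖ (ho a) vis) (strengthenʳ a ⊢P (a∉ ∘ ∈fn-inHO⇒repHO)) (¬InDom-∖ {Δ} (ho a) cur∉)
strengthenʳ {Δ} a (t-repFO vis ⊢P cur∉) a∉ =
  t-repFO (IsVis-∖ (ho a) vis) (strengthenʳ a ⊢P (a∉ ∘ ∈fn-inFO⇒repFO)) (¬InDom-∖ {Δ} (ho a) cur∉)
strengthenʳ a (t-succ vis) a∉ = t-succ (IsVis-∖ (ho a) vis)
strengthenʳ a (t-nuHO {Δ = Δ} {a = c} vis ⊢P e) a∉ with a ≟ c
... | yes refl = t-nuHO (IsVis-∖ (ho a) vis) ⊢P (≐-trans (∖-cong (ho a) e) (∖-idem {Δ} (ho a)))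
... | no a≢c = t-nuHO (IsVis-∖ (ho a) vis) (strengthenʳ a ⊢P λ m → a∉ (nuHO-body m a≢c))
                 (≐-trans (∖-cong (ho a) e) (∖-comm {Δ} (ho c) (ho a)))
strengthenʳ a (t-nuFO vis ⊢P) a∉ = t-nuFO (IsVis-∖ (ho a) vis) (strengthenʳ a ⊢P (a∉ ∘ nuFO-body))
strengthenʳ {Δ} a (t-nil vis cur∉) a∉ = t-nil (IsVis-∖ (ho a) vis) (¬InDom-∖ {Δ} (ho a) cur∉)
strengthenʳ a (t-sum vis ⊢P ⊢Q) a∉ =
  t-sum (IsVis-∖ (ho a) vis) (strengthenʳ a ⊢P (a∉ ∘ sum-l)) (strengthenʳ a ⊢Q (a∉ ∘ sum-r))
strengthenʳ a (t-ite vis ⊢P ⊢Q) a∉ =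
  t-ite (IsVis-∖ (ho a) vis) (strengthenʳ a ⊢P (a∉ ∘ ite-l)) (strengthenʳ a ⊢Q (a∉ ∘ ite-r))
strengthenʳ a (t-par vis split ⊢P ⊢Q) a∉ =
  t-par (IsVis-∖ (ho a) vis) (Split-∖ (ho a) split)
    (strengthenʳ a ⊢P (a∉ ∘ par-l)) (strengthenʳ a ⊢Q (a∉ ∘ par-r))

-- Free names and α-equivalence

swapN-left : ∀ a b → swapN a b a ≡ b
swapN-left a b with a ≟ a
... | yes _ = refl
... | no a≢a = ⊥-elim (a≢a refl)

swapN-right : ∀ a b → swapN a b b ≡ a
swapN-right a b with b ≟ a
... | yes refl = refl
... | no _ with b ≟ b
...   | yes _ = refl
...   | no b≢b = ⊥-elim (b≢b refl)

swapN-other : ∀ a b c → c ≢ a → c ≢ b → swapN a b c ≡ c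
swapN-other a b c c≢a c≢b with c ≟ a
... | yes c≡a = ⊥-elim (c≢a c≡a)
... | no _ with c ≟ b
...   | yes c≡b = ⊥-elim (c≢b c≡b)
...   | no _ = refl

swapN-involutive : ∀ a b c → swapN a b (swapN a b c) ≡ c
swapN-involutive a b c with c ≟ a
... | yes refl = swapN-right c b
... | no c≢a with c ≟ b
...   | yes refl = swapN-left a c
...   | no c≢b = swapN-other a b c c≢a c≢b

swapN-injective : ∀ a b {c d} → swapN a b c ≡ swapN a b d → c ≡ d
swapN-injective a b {c} {d} e =
  trans (sym (swapN-involutive a b c)) (trans (cong (swapN a b) e) (swapN-involutive a b d))

swap-involutive : ∀ a b P → swap a b (swap a b P) ≡ P
swap-involutive a b (inHO s x c P)
  rewrite swapN-involutive a b s | swapN-involutive a b c | swap-involutive a b P = refl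
swap-involutive a b (inFO h x P) rewrite swap-involutive a b P = refl
swap-involutive a b (outHO s e c P)
  rewrite swapN-involutive a b s | swapN-involutive a b c | swap-involutive a b P = refl
swap-involutive a b (outFO h e P) rewrite swap-involutive a b P = refl
swap-involutive a b (succ w P) rewrite swap-involutive a b P = refl
swap-involutive a b (repHO s x c P)
  rewrite swapN-involutive a b s | swapN-involutive a b c | swap-involutive a b P = refl
swap-involutive a b (repFO h x P) rewrite swap-involutive a b P = refl
swap-involutive a b (par P Q) rewrite swap-involutive a b P | swap-involutive a b Q = refl
swap-involutive a b (nuHO c P) rewrite swapN-involutive a b c | swap-involutive a b P = refl
swap-involutive a b (nuFO h P) rewrite swap-involutive a b P = refl
swap-involutive a b nil = refl
swap-involutive a b (sum P Q) rewrite swap-involutive a b P | swap-involutive a b Q = refl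
swap-involutive a b (ite e f P Q) rewrite swap-involutive a b P | swap-involutive a b Q = refl

∈fn-swap : ∀ a b {n P} → n ∈fn P → swapN a b n ∈fn swap a b P
∈fn-swap a b inHO-sub = inHO-sub
∈fn-swap a b (inHO-body m n≢c) = inHO-body (∈fn-swap a b m) (n≢c ∘ swapN-injective a b)
∈fn-swap a b (inFO-body m) = inFO-body (∈fn-swap a b m)
∈fn-swap a b outHO-sub = outHO-sub
∈fn-swap a b (outHO-body m n≢c) = outHO-body (∈fn-swap a b m) (n≢c ∘ swapN-injective a b)
∈fn-swap a b (outFO-body m) = outFO-body (∈fn-swap a b m)
∈fn-swap a b (succ-body m) = succ-body (∈fn-swap a b m)
∈fn-swap a b repHO-sub = repHO-sub
∈fn-swap a b (repHO-body m n≢c) = repHO-body (∈fn-swap a b m) (n≢c ∘ swapN-injective a b)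
∈fn-swap a b (repFO-body m) = repFO-body (∈fn-swap a b m)
∈fn-swap a b (par-l m) = par-l (∈fn-swap a b m)
∈fn-swap a b (par-r m) = par-r (∈fn-swap a b m)
∈fn-swap a b (nuHO-body m n≢c) = nuHO-body (∈fn-swap a b m) (n≢c ∘ swapN-injective a b)
∈fn-swap a b (nuFO-body m) = nuFO-body (∈fn-swap a b m)
∈fn-swap a b (sum-l m) = sum-l (∈fn-swap a b m)
∈fn-swap a b (sum-r m) = sum-r (∈fn-swap a b m)
∈fn-swap a b (ite-l m) = ite-l (∈fn-swap a b m)
∈fn-swap a b (ite-r m) = ite-r (∈fn-swap a b m)

∈fn⇒∈nm : ∀ {n P} → n ∈fn P → n ∈nm P
∈fn⇒∈nm inHO-sub = inHO-sub
∈fn⇒∈nm (inHO-body m _) = inHO-body (∈fn⇒∈nm m)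
∈fn⇒∈nm (inFO-body m) = inFO-body (∈fn⇒∈nm m)
∈fn⇒∈nm outHO-sub = outHO-sub
∈fn⇒∈nm (outHO-body m _) = outHO-body (∈fn⇒∈nm m)
∈fn⇒∈nm (outFO-body m) = outFO-body (∈fn⇒∈nm m)
∈fn⇒∈nm (succ-body m) = succ-body (∈fn⇒∈nm m)
∈fn⇒∈nm repHO-sub = repHO-sub
∈fn⇒∈nm (repHO-body m _) = repHO-body (∈fn⇒∈nm m)
∈fn⇒∈nm (repFO-body m) = repFO-body (∈fn⇒∈nm m)
∈fn⇒∈nm (par-l m) = par-l (∈fn⇒∈nm m)
∈fn⇒∈nm (par-r m) = par-r (∈fn⇒∈nm m)
∈fn⇒∈nm (nuHO-body m _) = nuHO-body (∈fn⇒∈nm m)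
∈fn⇒∈nm (nuFO-body m) = nuFO-body (∈fn⇒∈nm m)
∈fn⇒∈nm (sum-l m) = sum-l (∈fn⇒∈nm m)
∈fn⇒∈nm (sum-r m) = sum-r (∈fn⇒∈nm m)
∈fn⇒∈nm (ite-l m) = ite-l (∈fn⇒∈nm m)
∈fn⇒∈nm (ite-r m) = ite-r (∈fn⇒∈nm m)

∈fn-unswap-fresh : ∀ {n c b P} → ¬ (c ∈nm P) → n ≢ c → swapN b c n ∈fn P → n ∈fn P × n ≢ b
∈fn-unswap-fresh {n} {c} {b} {P} c∉P n≢c m = unswap (n ≟ b)
  where
  unswap : Dec (n ≡ b) → n ∈fn P × n ≢ b
  unswap (yes n≡b) = ⊥-elim (c∉P (∈fn⇒∈nm (subst (_∈fn P) swapN-b-c-n≡c m)))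
    where
    swapN-b-c-n≡c : swapN b c n ≡ c
    swapN-b-c-n≡c = trans (cong (swapN b c) n≡b) (swapN-left b c)
  unswap (no n≢b) = subst (_∈fn P) (swapN-other b c n n≢b n≢c) m , n≢b

-- c occurs in neither body, so swapping b' with c fixes a name n free in P'.
∈fn-under-binder : ∀ {n c b b' P P'} → FreshFor c b b' P P' →
                   (n ∈fn swap b' c P' → n ∈fn swap b c P) →
                   n ∈fn P' → n ≢ b' → n ∈fn P × n ≢ b
∈fn-under-binder {n} {c} {b} {b'} {P} {P'} (_ , _ , c∉P , c∉P') body n∈P' n≢b' =
  ∈fn-unswap-fresh c∉P n≢c
    (subst (swapN b c n ∈fn_) (swap-involutive b c P) (∈fn-swap b c (body n∈swapP')))
  where
  n≢c : n ≢ c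
  n≢c refl = c∉P' (∈fn⇒∈nm n∈P')
  n∈swapP' : n ∈fn swap b' c P'
  n∈swapP' = subst (_∈fn swap b' c P') (swapN-other b' c n n≢b' n≢c) (∈fn-swap b' c n∈P')

∈fn-=α : ∀ {n P Q} → P =α Q → n ∈fn Q → n ∈fn P
∈fn-=α (inHO c fr r) inHO-sub = inHO-sub
∈fn-=α (inHO c fr r) (inHO-body m n≢b) =
  let n∈P , n≢b' = ∈fn-under-binder fr (∈fn-=α r) m n≢b in inHO-body n∈P n≢b'
∈fn-=α (inFO r) (inFO-body m) = inFO-body (∈fn-=α r m)
∈fn-=α (outHO c fr r) outHO-sub = outHO-sub
∈fn-=α (outHO c fr r) (outHO-body m n≢b) =
  let n∈P , n≢b' = ∈fn-under-binder fr (∈fn-=α r) m n≢b in outHO-body n∈P n≢b'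
∈fn-=α (outFO r) (outFO-body m) = outFO-body (∈fn-=α r m)
∈fn-=α (succ r) (succ-body m) = succ-body (∈fn-=α r m)
∈fn-=α (repHO c fr r) repHO-sub = repHO-sub
∈fn-=α (repHO c fr r) (repHO-body m n≢b) =
  let n∈P , n≢b' = ∈fn-under-binder fr (∈fn-=α r) m n≢b in repHO-body n∈P n≢b'
∈fn-=α (repFO r) (repFO-body m) = repFO-body (∈fn-=α r m)
∈fn-=α (par r r') (par-l m) = par-l (∈fn-=α r m)
∈fn-=α (par r r') (par-r m) = par-r (∈fn-=α r' m)
∈fn-=α (nuHO c fr r) (nuHO-body m n≢b) =
  let n∈P , n≢b' = ∈fn-under-binder fr (∈fn-=α r) m n≢b in nuHO-body n∈P n≢b'
∈fn-=α (nuFO r) (nuFO-body m) = nuFO-body (∈fn-=α r m)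
∈fn-=α (sum r r') (sum-l m) = sum-l (∈fn-=α r m)
∈fn-=α (sum r r') (sum-r m) = sum-r (∈fn-=α r' m)
∈fn-=α (ite r r') (ite-l m) = ite-l (∈fn-=α r m)
∈fn-=α (ite r r') (ite-r m) = ite-r (∈fn-=α r' m)

mainTheorem14 : (Δ : VMap) (P : Proc) (a : HName) →
    IsVis Δ → Δ ⊢ P → ¬ (a ∈fn P) → (Δ ∖ ho a) ⊢ P
mainTheorem14 Δ P a _ (Q , P=αQ , ⊢Q) a∉P = Q , P=αQ , strengthenʳ a ⊢Q (a∉P ∘ ∈fn-=α P=αQ)
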